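{- Let $k$ and $n$ be positive integers with $k$ dividing $n$, and let $T$ be any tree with $k$ edges. Then $T$ divides the hypercube $Q_n$ (i.e. there are embeddings of $T$ into $Q_n$ whose edge sets partition $E(Q_n)$).
   Context: $Q_n$ is the $n$-dimensional hypercube: vertex set the subsets of $\{1,\ldots,n\}$, with $x,y$ adjacent iff $|x\,\Delta\, y|=1$. If $H$ is isomorphic to a subgraph of $G$, $H$ divides $G$ if there exist embeddings $\theta_1,\ldots,\theta_r$ of $H$ into $G$ such that $\{E(\theta_1(H)),\ldots,E(\theta_r(H))\}$ is a partition of $E(G)$. -}

module Defs where

open import Data.Nat using (ℕ; zero; suc; _+_; _<ᵇ_)
open import Data.Bool using (Bool; true; false; _∧_; if_then_else_; _xor_)
open import Data.Fin using (Fin; zero; suc; toℕ; inject₁; fromℕ)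
open import Data.Vec using (Vec; []; _∷_)
open import Data.List using (List; map; allFin)
open import Data.Nat.ListAction using (sum)
open import Data.Product using (Σ; _×_; _,_; ∃)
open import Relation.Binary.PropositionalEquality using (_≡_)
open import Relation.Nullary using (¬_)
open import Function.Definitions using (Injective)

record Graph : Set where
  field
    V      : ℕ
    adj    : Fin V → Fin V → Bool
    sym    : ∀ a b → adj a b ≡ adj b a
    irrefl : ∀ a → adj a a ≡ false
open Graph public

Adj : (G : Graph) → Fin (V G) → Fin (V G) → Set
Adj G a b = adj G a b ≡ true

data Reach (G : Graph) : Fin (V G) → Fin (V G) → Set where
  here : ∀ {a} → Reach G a a
  step : ∀ {a b c} → Adj G a b → Reach G b c → Reach G a c

Connected : Graph → Set
Connected G = ∀ a b → Reach G a b

IsCycle : (G : Graph) (m : ℕ) → (Fin (3 + m) → Fin (V G)) → Set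
IsCycle G m c =
  Injective _≡_ _≡_ c ×
  (∀ (i : Fin (2 + m)) → Adj G (c (inject₁ i)) (c (suc i))) ×
  Adj G (c (fromℕ (2 + m))) (c zero)

Acyclic : Graph → Set
Acyclic G = ∀ m (c : Fin (3 + m) → Fin (V G)) → ¬ IsCycle G m c

IsTree : Graph → Set
IsTree G = Connected G × Acyclic G

edgeCount : Graph → ℕ
edgeCount G = sum (map (λ a → sum (map (λ b →
  if (toℕ a <ᵇ toℕ b) ∧ adj G a b then 1 else 0) (allFin (V G)))) (allFin (V G)))

-- The hypercube Q_n: vertices are subsets of {1..n} as characteristic vectors,
-- adjacent iff the symmetric difference has size 1.
QVertex : ℕ → Set
QVertex n = Vec Bool n

symDiffSize : ∀ {n} → QVertex n → QVertex n → ℕ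
symDiffSize [] [] = 0
symDiffSize (x ∷ xs) (y ∷ ys) = (if x xor y then 1 else 0) + symDiffSize xs ys

QAdj : ∀ {n} → QVertex n → QVertex n → Set
QAdj x y = symDiffSize x y ≡ 1

record Embedding (H : Graph) (n : ℕ) : Set where
  field
    vmap      : Fin (V H) → QVertex n
    injective : Injective _≡_ _≡_ vmap
    preserves : ∀ a b → Adj H a b → QAdj (vmap a) (vmap b)
open Embedding public

-- the edges of the images of θ_1..θ_r partition E(Q_n): every (oriented) edge
-- (x,y) of Q_n is the image of exactly one (i, oriented edge (a,b) of H).
CoversAt : ∀ {H n r} → (Fin r → Embedding H n) → QVertex n → QVertex n
         → Σ (Fin r) (λ _ → Fin (V H) × Fin (V H)) → Set
CoversAt {H} θ x y (i , a , b) = Adj H a b × Embedding.vmap (θ i) a ≡ x × Embedding.vmap (θ i) b ≡ y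

Divides : Graph → ℕ → Set
Divides H n =
  Σ ℕ λ r → Σ (Fin r → Embedding H n) λ θ →
    ∀ (x y : QVertex n) → QAdj x y →
      Σ (Σ (Fin r) (λ _ → Fin (V H) × Fin (V H))) λ t →
        CoversAt θ x y t × (∀ t′ → CoversAt θ x y t′ → t′ ≡ t)

module Submission where

-- Write n = q·k.  Index the edges of T by Fin k and send each vertex v of T
-- to the vertex φ v of Q_k whose p-th coordinate records on which side of
-- the p-th edge v lies.  Then φ is injective and maps the p-th edge of T to
-- an edge of Q_k in direction p (a "cube labelling" of T).  Split the
-- coordinates of Q_{q·k} into q blocks of k.  For every block j and every
-- translation x of even parity, v ↦ x ⊕ (φ v placed in block j) embeds T,
-- and these embeddings partition E(Q_{q·k}): an edge y – z whose direction
-- is coordinate p of block j is the image of the p-th edge of T under exactly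
-- two such maps of block j (one per orientation of that edge), and their
-- translations differ in one coordinate, so exactly one of them is even.

open import Defs hiding (sym)

open import Algebra.Bundles using (CommutativeRing)
open import Data.Bool using (Bool; true; false; not; _xor_; _∧_; if_then_else_; T; T?)
open import Data.Bool.Properties
  using (xor-assoc; xor-comm; xor-same; xor-identityʳ; xor-∧-commutativeRing; T-∧; T-≡)
  renaming (_≟_ to _≟ᵇ_)
open import Algebra.Properties.CommutativeSemigroup
  (CommutativeRing.+-commutativeSemigroup xor-∧-commutativeRing) using (interchange)
open import Data.Empty using (⊥)
open import Data.Fin using (Fin; zero; suc; toℕ; inject₁; fromℕ; _↑ˡ_; _↑ʳ_; combine; remQuot)
open import Data.Fin.Properties
  using (_≟_; <-cmp; combine-injective; combine-remQuot; any?; injective⇒≤)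
open import Data.Fin.Subset using (⁅_⁆; ∣_∣; _∈_) renaming (⊥ to ∅)
open import Data.Fin.Subset.Properties using (∣⁅x⁆∣≡1; x∈⁅x⁆; x∈⁅y⁆⇒x≡y)
open import Data.List as List using (List; []; _∷_; map; length; filter; cartesianProduct; allFin)
open import Data.List.Properties using (map-++; map-∘)
open import Data.List.Membership.Propositional using () renaming (_∈_ to _∈ₗ_)
open import Data.List.Membership.Propositional.Properties
  using (∈-lookup; ∈-filter⁺; ∈-filter⁻; ∈-++⁺ˡ; ∈-++⁺ʳ; ∈-map⁺; ∈-map⁻; ∈-allFin; ∈-cartesianProduct⁺)
open import Data.List.Relation.Unary.All as All using ([]; _∷_)
open import Data.List.Relation.Unary.AllPairs using ([]; _∷_)
open import Data.List.Relation.Unary.Any as Any using (here)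
open import Data.List.Relation.Unary.Any.Properties using (lookup-index)
open import Data.List.Relation.Unary.Unique.Propositional using (Unique)
import Data.List.Relation.Unary.Unique.Propositional.Properties as Unique
open import Data.Nat using (ℕ; zero; suc; _+_; _*_; _≤_; _<_; s≤s; _<ᵇ_)
open import Data.Nat.Divisibility using (_∣_; divides)
open import Data.Nat.ListAction using (sum)
open import Data.Nat.ListAction.Properties using (sum-++)
open import Data.Nat.Properties using (suc-injective; <ᵇ⇒<; <⇒<ᵇ; <-asym; <⇒≤)
open import Data.Product using (Σ; _×_; _,_; proj₁; proj₂; swap)
open import Data.Product.Properties using (≡-dec)
open import Data.Sum using (_⊎_; inj₁; inj₂; [_,_]) renaming (swap to swap⊎)
open import Data.Vec using (Vec; []; _∷_; zipWith; _++_; lookup; tabulate)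
open import Data.Vec.Properties
  using (zipWith-++; ++-injectiveˡ; ++-injectiveʳ; ∷-injectiveʳ; tabulate∘lookup; tabulate-cong;
         lookup∘tabulate; lookup-zipWith)
open import Function using (_∘_)
open import Function.Bundles using (Equivalence; mk⇔)
open import Function.Definitions using (Injective)
open import Relation.Binary.Definitions using (tri<; tri≈; tri>)
open import Relation.Binary.PropositionalEquality
  using (_≡_; _≢_; refl; sym; trans; cong; cong₂; subst; subst₂; module ≡-Reasoning)
open import Relation.Nullary using (¬_; Dec; yes; no; does; contradiction)
open import Relation.Nullary.Decidable
  using (map′; _⊎-dec_; _×-dec_; ¬?; does-⇔; dec-true; dec-false)
open import Relation.Unary using (Decidable)
open ≡-Reasoning

infixl 6 _⊕_

_⊕_ : ∀ {n} → QVertex n → QVertex n → QVertex n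
_⊕_ = zipWith _xor_

⊕-assoc : ∀ {n} (x y z : QVertex n) → (x ⊕ y) ⊕ z ≡ x ⊕ (y ⊕ z)
⊕-assoc []      []      []      = refl
⊕-assoc (a ∷ x) (b ∷ y) (c ∷ z) = cong₂ _∷_ (xor-assoc a b c) (⊕-assoc x y z)

⊕-comm : ∀ {n} (x y : QVertex n) → x ⊕ y ≡ y ⊕ x
⊕-comm []      []      = refl
⊕-comm (a ∷ x) (b ∷ y) = cong₂ _∷_ (xor-comm a b) (⊕-comm x y)

⊕-self : ∀ {n} (x : QVertex n) → x ⊕ x ≡ ∅
⊕-self []      = refl
⊕-self (a ∷ x) = cong₂ _∷_ (xor-same a) (⊕-self x)

⊕-identityʳ : ∀ {n} (x : QVertex n) → x ⊕ ∅ ≡ x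
⊕-identityʳ []      = refl
⊕-identityʳ (a ∷ x) = cong₂ _∷_ (xor-identityʳ a) (⊕-identityʳ x)

⊕-cancelʳ : ∀ {n} (x y : QVertex n) → (x ⊕ y) ⊕ y ≡ x
⊕-cancelʳ x y = begin
  (x ⊕ y) ⊕ y  ≡⟨ ⊕-assoc x y y ⟩
  x ⊕ (y ⊕ y)  ≡⟨ cong (x ⊕_) (⊕-self y) ⟩
  x ⊕ ∅        ≡⟨ ⊕-identityʳ x ⟩
  x            ∎

⊕-cancelˡ : ∀ {n} (x y : QVertex n) → x ⊕ (x ⊕ y) ≡ y
⊕-cancelˡ x y = begin
  x ⊕ (x ⊕ y)  ≡⟨ ⊕-comm x (x ⊕ y) ⟩
  (x ⊕ y) ⊕ x  ≡⟨ cong (_⊕ x) (⊕-comm x y) ⟩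
  (y ⊕ x) ⊕ x  ≡⟨ ⊕-cancelʳ y x ⟩
  y            ∎

⊕-solve : ∀ {n} {x u y : QVertex n} → x ⊕ u ≡ y → x ≡ y ⊕ u
⊕-solve {x = x} {u} refl = sym (⊕-cancelʳ x u)

⊕-injectiveˡ : ∀ {n} (x : QVertex n) {u v : QVertex n} → x ⊕ u ≡ x ⊕ v → u ≡ v
⊕-injectiveˡ x {u} {v} eq = begin
  u            ≡⟨ sym (⊕-cancelˡ x u) ⟩
  x ⊕ (x ⊕ u)  ≡⟨ cong (x ⊕_) eq ⟩
  x ⊕ (x ⊕ v)  ≡⟨ ⊕-cancelˡ x v ⟩
  v            ∎

⊕-translate : ∀ {n} (x u v : QVertex n) → (x ⊕ u) ⊕ (x ⊕ v) ≡ u ⊕ v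
⊕-translate x u v = begin
  (x ⊕ u) ⊕ (x ⊕ v)  ≡⟨ cong (_⊕ (x ⊕ v)) (⊕-comm x u) ⟩
  (u ⊕ x) ⊕ (x ⊕ v)  ≡⟨ ⊕-assoc u x (x ⊕ v) ⟩
  u ⊕ (x ⊕ (x ⊕ v))  ≡⟨ cong (u ⊕_) (⊕-cancelˡ x v) ⟩
  u ⊕ v              ∎

pointwise : ∀ {n} {x y : QVertex n} → (∀ i → lookup x i ≡ lookup y i) → x ≡ y
pointwise {x = x} {y} eq = begin
  x                   ≡⟨ sym (tabulate∘lookup x) ⟩
  tabulate (lookup x) ≡⟨ tabulate-cong eq ⟩
  tabulate (lookup y) ≡⟨ tabulate∘lookup y ⟩
  y                   ∎

symDiffSize≡∣⊕∣ : ∀ {n} (x y : QVertex n) → symDiffSize x y ≡ ∣ x ⊕ y ∣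
symDiffSize≡∣⊕∣ []      []      = refl
symDiffSize≡∣⊕∣ (a ∷ x) (b ∷ y) with a xor b
... | true  = cong suc (symDiffSize≡∣⊕∣ x y)
... | false = symDiffSize≡∣⊕∣ x y

∣p∣≡0⇒p≡∅ : ∀ {n} (p : QVertex n) → ∣ p ∣ ≡ 0 → p ≡ ∅
∣p∣≡0⇒p≡∅ []          _ = refl
∣p∣≡0⇒p≡∅ (false ∷ p) e = cong (false ∷_) (∣p∣≡0⇒p≡∅ p e)

∣p∣≡1⇒singleton : ∀ {n} (p : QVertex n) → ∣ p ∣ ≡ 1 → Σ (Fin n) λ i → p ≡ ⁅ i ⁆
∣p∣≡1⇒singleton (true  ∷ p) e = zero , cong (true ∷_) (∣p∣≡0⇒p≡∅ p (suc-injective e))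
∣p∣≡1⇒singleton (false ∷ p) e =
  let i , p≡⁅i⁆ = ∣p∣≡1⇒singleton p e in suc i , cong (false ∷_) p≡⁅i⁆

adjacent⇒singleton : ∀ {n} {x y : QVertex n} → QAdj x y → Σ (Fin n) λ i → x ⊕ y ≡ ⁅ i ⁆
adjacent⇒singleton {x = x} {y} xy = ∣p∣≡1⇒singleton (x ⊕ y) (trans (sym (symDiffSize≡∣⊕∣ x y)) xy)

singleton⇒adjacent : ∀ {n} {x y : QVertex n} (i : Fin n) → x ⊕ y ≡ ⁅ i ⁆ → QAdj x y
singleton⇒adjacent {x = x} {y} i eq = begin
  symDiffSize x y  ≡⟨ symDiffSize≡∣⊕∣ x y ⟩
  ∣ x ⊕ y ∣        ≡⟨ cong ∣_∣ eq ⟩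
  ∣ ⁅ i ⁆ ∣        ≡⟨ ∣⁅x⁆∣≡1 i ⟩
  1                ∎

⁅⁆-injective : ∀ {n} {i j : Fin n} → ⁅ i ⁆ ≡ ⁅ j ⁆ → i ≡ j
⁅⁆-injective {i = i} {j} eq = x∈⁅y⁆⇒x≡y j (subst (i ∈_) eq (x∈⁅x⁆ i))

lookup-⁅⁆ : ∀ {n} (i j : Fin n) → lookup ⁅ i ⁆ j ≡ does (j ≟ i)
lookup-⁅⁆ zero    zero    = refl
lookup-⁅⁆ (suc i) zero    = refl
lookup-⁅⁆ zero    (suc j) = lookup-∅ j
  where lookup-∅ : ∀ {n} (j : Fin n) → lookup ∅ j ≡ false
        lookup-∅ zero    = refl
        lookup-∅ (suc j) = lookup-∅ j
lookup-⁅⁆ (suc i) (suc j) = lookup-⁅⁆ i j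

parity : ∀ {n} → QVertex n → Bool
parity []      = false
parity (a ∷ x) = a xor parity x

parity-⊕ : ∀ {n} (x y : QVertex n) → parity (x ⊕ y) ≡ parity x xor parity y
parity-⊕ []      []      = refl
parity-⊕ (a ∷ x) (b ∷ y) = begin
  (a xor b) xor parity (x ⊕ y)              ≡⟨ cong ((a xor b) xor_) (parity-⊕ x y) ⟩
  (a xor b) xor (parity x xor parity y)     ≡⟨ interchange a b (parity x) (parity y) ⟩
  (a xor parity x) xor (b xor parity y)     ∎

parity-⁅⁆ : ∀ {n} (i : Fin n) → parity ⁅ i ⁆ ≡ true
parity-⁅⁆ {suc n} zero = cong (true xor_) (parity-∅ n)
  where parity-∅ : ∀ n → parity (∅ {n}) ≡ false
        parity-∅ zero    = refl
        parity-∅ (suc n) = parity-∅ n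
parity-⁅⁆ (suc i) = parity-⁅⁆ i

parity-flip : ∀ {n} (x y : QVertex n) (i : Fin n) → x ⊕ y ≡ ⁅ i ⁆ → parity y ≡ not (parity x)
parity-flip x y i eq = begin
  parity y                   ≡⟨ cong parity (sym (⊕-cancelˡ x y)) ⟩
  parity (x ⊕ (x ⊕ y))       ≡⟨ parity-⊕ x (x ⊕ y) ⟩
  parity x xor parity (x ⊕ y) ≡⟨ cong (λ s → parity x xor parity s) eq ⟩
  parity x xor parity ⁅ i ⁆   ≡⟨ cong (parity x xor_) (parity-⁅⁆ i) ⟩
  parity x xor true          ≡⟨ xor-comm (parity x) true ⟩
  not (parity x)             ∎

∅-++ : ∀ m {n} → ∅ {m + n} ≡ ∅ {m} ++ ∅ {n}
∅-++ zero    = refl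
∅-++ (suc m) = cong (false ∷_) (∅-++ m)

⁅↑ˡ⁆ : ∀ {m} (i : Fin m) n → ⁅ i ↑ˡ n ⁆ ≡ ⁅ i ⁆ ++ ∅ {n}
⁅↑ˡ⁆ {suc m} zero    n = cong (true ∷_) (∅-++ m)
⁅↑ˡ⁆         (suc i) n = cong (false ∷_) (⁅↑ˡ⁆ i n)

⁅↑ʳ⁆ : ∀ m {n} (i : Fin n) → ⁅ m ↑ʳ i ⁆ ≡ ∅ {m} ++ ⁅ i ⁆
⁅↑ʳ⁆ zero    i = refl
⁅↑ʳ⁆ (suc m) i = cong (false ∷_) (⁅↑ʳ⁆ m i)

inBlock : ∀ {q K} → Fin q → QVertex K → QVertex (q * K)
inBlock {suc q} zero    w = w ++ ∅
inBlock {suc q} (suc j) w = ∅ ++ inBlock j w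

inBlock-⊕ : ∀ {q K} (j : Fin q) (u v : QVertex K) → inBlock j (u ⊕ v) ≡ inBlock j u ⊕ inBlock j v
inBlock-⊕ {suc q} zero u v = begin
  (u ⊕ v) ++ ∅                ≡⟨ cong ((u ⊕ v) ++_) (sym (⊕-self ∅)) ⟩
  (u ⊕ v) ++ (∅ ⊕ ∅)          ≡⟨ sym (zipWith-++ _xor_ u ∅ v ∅) ⟩
  (u ++ ∅) ⊕ (v ++ ∅)         ∎
inBlock-⊕ {suc q} (suc j) u v = begin
  ∅ ++ inBlock j (u ⊕ v)                  ≡⟨ cong₂ _++_ (sym (⊕-self ∅)) (inBlock-⊕ j u v) ⟩
  (∅ ⊕ ∅) ++ (inBlock j u ⊕ inBlock j v)  ≡⟨ sym (zipWith-++ _xor_ ∅ (inBlock j u) ∅ (inBlock j v)) ⟩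
  (∅ ++ inBlock j u) ⊕ (∅ ++ inBlock j v) ∎

inBlock-⁅⁆ : ∀ {q K} (j : Fin q) (p : Fin K) → inBlock j ⁅ p ⁆ ≡ ⁅ combine j p ⁆
inBlock-⁅⁆ {suc q} {K} zero    p = sym (⁅↑ˡ⁆ p (q * K))
inBlock-⁅⁆ {suc q} {K} (suc j) p = trans (cong (∅ ++_) (inBlock-⁅⁆ j p)) (sym (⁅↑ʳ⁆ K (combine j p)))

inBlock-injective : ∀ {q K} (j : Fin q) {u v : QVertex K} → inBlock j u ≡ inBlock j v → u ≡ v
inBlock-injective {suc q} zero    {u} {v} eq = ++-injectiveˡ u v eq
inBlock-injective {suc q} (suc j)         eq = inBlock-injective j (++-injectiveʳ ∅ ∅ eq)

lookup-injective : ∀ {A : Set} {xs : List A} → Unique xs →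
                   ∀ {i j} → List.lookup xs i ≡ List.lookup xs j → i ≡ j
lookup-injective (_ ∷ _)                {zero}  {zero}  _  = refl
lookup-injective {xs = _ ∷ xs} (x∉ ∷ _) {zero}  {suc j} eq =
  contradiction eq (All.lookup x∉ (∈-lookup {xs = xs} j))
lookup-injective {xs = _ ∷ xs} (x∉ ∷ _) {suc i} {zero}  eq =
  contradiction (sym eq) (All.lookup x∉ (∈-lookup {xs = xs} i))
lookup-injective (_ ∷ u)                {suc i} {suc j} eq = cong suc (lookup-injective u eq)

allVertices : ∀ n → List (QVertex n)
allVertices zero    = [] ∷ []
allVertices (suc n) = map (true ∷_) (allVertices n) List.++ map (false ∷_) (allVertices n)

∈-allVertices : ∀ {n} (x : QVertex n) → x ∈ₗ allVertices n
∈-allVertices []          = here refl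
∈-allVertices (true ∷ x)  = ∈-++⁺ˡ (∈-map⁺ (true ∷_) (∈-allVertices x))
∈-allVertices {suc n} (false ∷ x) =
  ∈-++⁺ʳ (map (true ∷_) (allVertices n)) (∈-map⁺ (false ∷_) (∈-allVertices x))

allVertices-unique : ∀ n → Unique (allVertices n)
allVertices-unique zero    = [] ∷ []
allVertices-unique (suc n) =
  Unique.++⁺ (Unique.map⁺ ∷-injectiveʳ (allVertices-unique n))
             (Unique.map⁺ ∷-injectiveʳ (allVertices-unique n)) disjoint
  where
    disjoint : ∀ {x} → x ∈ₗ map (true ∷_) (allVertices n) × x ∈ₗ map (false ∷_) (allVertices n) → ⊥
    disjoint (t , f) with ∈-map⁻ (true ∷_) t | ∈-map⁻ (false ∷_) f
    ... | _ , _ , refl | _ , _ , ()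

ExactlyOne : {A : Set} → (A → Set) → Set
ExactlyOne {A} P = Σ A λ a → P a × (∀ a′ → P a′ → a′ ≡ a)

Carries : ∀ {H n} {I : Set} → (I → Embedding H n) →
          QVertex n → QVertex n → I × Fin (V H) × Fin (V H) → Set
Carries {H} θ x y (i , a , b) = Adj H a b × vmap (θ i) a ≡ x × vmap (θ i) b ≡ y

dividesBySelection : ∀ {H n} {I : Set} {P : I → Set} (P? : Decidable P)
  (enum : List I) → Unique enum → (∀ i → i ∈ₗ enum) → (θ : I → Embedding H n) →
  (∀ x y → QAdj x y → ExactlyOne (λ t → P (proj₁ t) × Carries θ x y t)) →
  Divides H n
dividesBySelection {I = I} P? enum enum-unique enum-complete θ carriedOnce =
  length selected , θ ∘ List.lookup selected , coveredOnce
  where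
    selected : List I
    selected = filter P? enum

    selected-unique : Unique selected
    selected-unique = Unique.filter⁺ P? enum-unique

    coveredOnce : ∀ x y → QAdj x y → ExactlyOne (CoversAt (θ ∘ List.lookup selected) x y)
    coveredOnce x y xy with carriedOnce x y xy
    ... | (i , a , b) , (Pi , carries) , unique = (k , a , b) , carries′ , unique′
      where
        i∈ : i ∈ₗ selected
        i∈ = ∈-filter⁺ P? (enum-complete i) Pi
        k : Fin (length selected)
        k = Any.index i∈
        lookup-k : List.lookup selected k ≡ i
        lookup-k = sym (lookup-index i∈)
        carries′ : Carries θ x y (List.lookup selected k , a , b)
        carries′ = subst (λ j → Carries θ x y (j , a , b)) (sym lookup-k) carries
        unique′ : ∀ t → CoversAt (θ ∘ List.lookup selected) x y t → t ≡ (k , a , b)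
        unique′ (s , c , d) covers =
          cong₂ _,_ (lookup-injective selected-unique (trans (cong proj₁ same) (sym lookup-k)))
                    (cong proj₂ same)
          where
            same : (List.lookup selected s , c , d) ≡ (i , a , b)
            same = unique _ (proj₂ (∈-filter⁻ P? {xs = enum} (∈-lookup {xs = selected} s)) , covers)

record EdgeIndexing (H : Graph) (K : ℕ) : Set where
  field
    edge        : Fin K → Fin (V H) × Fin (V H)
    edge-adj    : ∀ p → Adj H (proj₁ (edge p)) (proj₂ (edge p))
    edge-onto   : ∀ {c d} → Adj H c d → Σ (Fin K) λ p → edge p ≡ (c , d) ⊎ edge p ≡ (d , c)
    edge-unique : ∀ p p′ → edge p′ ≡ edge p ⊎ edge p′ ≡ swap (edge p) → p′ ≡ p

length-filter : ∀ {A : Set} (g : A → Bool) (xs : List A) →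
                length (filter (T? ∘ g) xs) ≡ sum (map (λ x → if g x then 1 else 0) xs)
length-filter g []       = refl
length-filter g (x ∷ xs) with g x
... | true  = cong suc (length-filter g xs)
... | false = length-filter g xs

sum-cartesianProduct : ∀ {A B : Set} (f : A × B → ℕ) (xs : List A) (ys : List B) →
  sum (map f (cartesianProduct xs ys)) ≡ sum (map (λ a → sum (map (λ b → f (a , b)) ys)) xs)
sum-cartesianProduct f []       ys = refl
sum-cartesianProduct f (x ∷ xs) ys = begin
  sum (map f (map (x ,_) ys List.++ cartesianProduct xs ys))
    ≡⟨ cong sum (map-++ f (map (x ,_) ys) (cartesianProduct xs ys)) ⟩
  sum (map f (map (x ,_) ys) List.++ map f (cartesianProduct xs ys))
    ≡⟨ sum-++ (map f (map (x ,_) ys)) (map f (cartesianProduct xs ys)) ⟩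
  sum (map f (map (x ,_) ys)) + sum (map f (cartesianProduct xs ys))
    ≡⟨ cong₂ _+_ (cong sum (sym (map-∘ ys))) (sum-cartesianProduct f xs ys) ⟩
  sum (map (λ b → f (x , b)) ys) + sum (map (λ a → sum (map (λ b → f (a , b)) ys)) xs)
    ∎

module EdgeList (H : Graph) where

  pairs : List (Fin (V H) × Fin (V H))
  pairs = cartesianProduct (allFin (V H)) (allFin (V H))

  isEdge : Fin (V H) × Fin (V H) → Bool
  isEdge (a , b) = (toℕ a <ᵇ toℕ b) ∧ adj H a b

  edges : List (Fin (V H) × Fin (V H))
  edges = filter (T? ∘ isEdge) pairs

  edgeCount≡length : edgeCount H ≡ length edges
  edgeCount≡length =
    sym (trans (length-filter isEdge pairs) (sum-cartesianProduct _ (allFin (V H)) (allFin (V H))))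

  edges-unique : Unique edges
  edges-unique = Unique.filter⁺ (T? ∘ isEdge)
    (Unique.cartesianProduct⁺ (Unique.allFin⁺ (V H)) (Unique.allFin⁺ (V H)))

  isEdge-sound : ∀ {a b} → T (isEdge (a , b)) → toℕ a < toℕ b × Adj H a b
  isEdge-sound {a} {b} t =
    let a<b , ab = Equivalence.to T-∧ t in <ᵇ⇒< (toℕ a) (toℕ b) a<b , Equivalence.to T-≡ ab

  edge : Fin (length edges) → Fin (V H) × Fin (V H)
  edge = List.lookup edges

  edge-ordered : ∀ p → toℕ (proj₁ (edge p)) < toℕ (proj₂ (edge p)) ×
                       Adj H (proj₁ (edge p)) (proj₂ (edge p))
  edge-ordered p = isEdge-sound (proj₂ (∈-filter⁻ (T? ∘ isEdge) {xs = pairs} (∈-lookup {xs = edges} p)))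

  indexOf : ∀ {a b} → toℕ a < toℕ b → Adj H a b → Σ (Fin (length edges)) λ p → edge p ≡ (a , b)
  indexOf {a} {b} a<b ab = Any.index ab∈ , sym (lookup-index ab∈)
    where
      ab∈ : (a , b) ∈ₗ edges
      ab∈ = ∈-filter⁺ (T? ∘ isEdge) (∈-cartesianProduct⁺ (∈-allFin a) (∈-allFin b))
              (Equivalence.from T-∧ (<⇒<ᵇ a<b , Equivalence.from T-≡ ab))

  edge-onto : ∀ {c d} → Adj H c d → Σ (Fin (length edges)) λ p → edge p ≡ (c , d) ⊎ edge p ≡ (d , c)
  edge-onto {c} {d} cd with <-cmp c d
  ... | tri< c<d _ _ = let p , eq = indexOf c<d cd in p , inj₁ eq
  ... | tri≈ _ refl _ = contradiction (trans (sym cd) (irrefl H c)) λ ()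
  ... | tri> _ _ d<c = let p , eq = indexOf d<c (trans (Graph.sym H d c) cd) in p , inj₂ eq

  edge-unique : ∀ p p′ → edge p′ ≡ edge p ⊎ edge p′ ≡ swap (edge p) → p′ ≡ p
  edge-unique p p′ (inj₁ eq) = lookup-injective edges-unique eq
  edge-unique p p′ (inj₂ eq) = contradiction (proj₁ (edge-ordered p))
    (<-asym (subst (λ e → toℕ (proj₁ e) < toℕ (proj₂ e)) eq (proj₁ (edge-ordered p′))))

  indexing : EdgeIndexing H (length edges)
  indexing = record { edge = edge ; edge-adj = proj₂ ∘ edge-ordered
                    ; edge-onto = edge-onto ; edge-unique = edge-unique }

edgeIndexing : (H : Graph) → EdgeIndexing H (edgeCount H)
edgeIndexing H = subst (EdgeIndexing H) (sym edgeCount≡length) indexing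
  where open EdgeList H

record CubeLabelling (H : Graph) (K : ℕ) : Set where
  field
    indexing : EdgeIndexing H K
  open EdgeIndexing indexing public
  field
    φ      : Fin (V H) → QVertex K
    φ-edge : ∀ p → φ (proj₁ (edge p)) ⊕ φ (proj₂ (edge p)) ≡ ⁅ p ⁆

  direction : ∀ {c d} → Adj H c d →
              Σ (Fin K) λ p → (edge p ≡ (c , d) ⊎ edge p ≡ (d , c)) × φ c ⊕ φ d ≡ ⁅ p ⁆
  direction cd with edge-onto cd
  ... | p , inj₁ eq = p , inj₁ eq , subst (λ e → φ (proj₁ e) ⊕ φ (proj₂ e) ≡ ⁅ p ⁆) eq (φ-edge p)
  ... | p , inj₂ eq = p , inj₂ eq ,
    trans (⊕-comm _ _) (subst (λ e → φ (proj₁ e) ⊕ φ (proj₂ e) ≡ ⁅ p ⁆) eq (φ-edge p))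

module BlockConstruction {H : Graph} {K : ℕ} (L : CubeLabelling H K)
         (φ-injective : Injective _≡_ _≡_ (CubeLabelling.φ L)) (q : ℕ) where
  open CubeLabelling L

  N : ℕ
  N = q * K

  Index : Set
  Index = Fin q × QVertex N

  place : Index → Fin (V H) → QVertex N
  place (j , x) v = x ⊕ inBlock j (φ v)

  place-edge : ∀ j x {c d p} → φ c ⊕ φ d ≡ ⁅ p ⁆ →
               place (j , x) c ⊕ place (j , x) d ≡ ⁅ combine j p ⁆
  place-edge j x {c} {d} {p} cd = begin
    place (j , x) c ⊕ place (j , x) d      ≡⟨ ⊕-translate x (inBlock j (φ c)) (inBlock j (φ d)) ⟩
    inBlock j (φ c) ⊕ inBlock j (φ d)      ≡⟨ sym (inBlock-⊕ j (φ c) (φ d)) ⟩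
    inBlock j (φ c ⊕ φ d)                  ≡⟨ cong (inBlock j) cd ⟩
    inBlock j ⁅ p ⁆                        ≡⟨ inBlock-⁅⁆ j p ⟩
    ⁅ combine j p ⁆                        ∎

  θ : Index → Embedding H N
  θ (j , x) = record
    { vmap      = place (j , x)
    ; injective = λ eq → φ-injective (inBlock-injective j (⊕-injectiveˡ x eq))
    ; preserves = λ _ _ cd → let _ , _ , φcd = direction cd in
                             singleton⇒adjacent _ (place-edge j x φcd)
    }

  Even : Index → Set
  Even (_ , x) = parity x ≡ false

  module Carriers (y z : QVertex N) (i₀ : Fin N) (yz : y ⊕ z ≡ ⁅ i₀ ⁆) where
    j : Fin q
    j = proj₁ (remQuot {q} K i₀)
    p : Fin K
    p = proj₂ (remQuot {q} K i₀)
    combine-jp : combine j p ≡ i₀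
    combine-jp = combine-remQuot {q} K i₀
    a b : Fin (V H)
    a = proj₁ (edge p)
    b = proj₂ (edge p)

    -- the embedding of block j translated so that c goes to y, applied to c → d
    candidate : Fin (V H) → Fin (V H) → Index × Fin (V H) × Fin (V H)
    candidate c d = (j , place (j , y) c) , c , d

    candidate-carries : ∀ {c d} → Adj H c d → φ c ⊕ φ d ≡ ⁅ p ⁆ → Carries θ y z (candidate c d)
    candidate-carries {c} {d} cd φcd = cd , ⊕-cancelʳ y (inBlock j (φ c)) , (begin
      place (j , y) c ⊕ inBlock j (φ d)                          ≡⟨ ⊕-assoc y _ _ ⟩
      y ⊕ (inBlock j (φ c) ⊕ inBlock j (φ d))                   ≡⟨ cong (y ⊕_) (sym (⊕-translate y _ _)) ⟩
      y ⊕ (place (j , y) c ⊕ place (j , y) d)                   ≡⟨ cong (y ⊕_) (place-edge j y φcd) ⟩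
      y ⊕ ⁅ combine j p ⁆                                        ≡⟨ cong (λ i → y ⊕ ⁅ i ⁆) combine-jp ⟩
      y ⊕ ⁅ i₀ ⁆                                                 ≡⟨ cong (y ⊕_) (sym yz) ⟩
      y ⊕ (y ⊕ z)                                                ≡⟨ ⊕-cancelˡ y z ⟩
      z                                                          ∎)

    carries-ab : Carries θ y z (candidate a b)
    carries-ab = candidate-carries (edge-adj p) (φ-edge p)

    carries-ba : Carries θ y z (candidate b a)
    carries-ba = candidate-carries (trans (Graph.sym H b a) (edge-adj p))
                                   (trans (⊕-comm (φ b) (φ a)) (φ-edge p))

    candidate-eq : ∀ {x c d} u w → x ≡ place (j , y) c → c ≡ u → d ≡ w →
                   ((j , x) , c , d) ≡ candidate u w
    candidate-eq _ _ refl refl refl = refl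

    carrier⇒candidate : ∀ t → Carries θ y z t → t ≡ candidate a b ⊎ t ≡ candidate b a
    carrier⇒candidate ((j′ , x) , c , d) (cd , xc , xd) with direction cd
    ... | p′ , orient , φcd with combine-injective j′ p′ j p (⁅⁆-injective (begin
          ⁅ combine j′ p′ ⁆                     ≡⟨ sym (place-edge j′ x φcd) ⟩
          place (j′ , x) c ⊕ place (j′ , x) d    ≡⟨ cong₂ _⊕_ xc xd ⟩
          y ⊕ z                                 ≡⟨ yz ⟩
          ⁅ i₀ ⁆                                ≡⟨ cong ⁅_⁆ (sym combine-jp) ⟩
          ⁅ combine j p ⁆                       ∎))
    ... | refl , refl with orient
    ...   | inj₁ e = inj₁ (candidate-eq a b (⊕-solve xc) (sym (cong proj₁ e)) (sym (cong proj₂ e)))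
    ...   | inj₂ e = inj₂ (candidate-eq b a (⊕-solve xc) (sym (cong proj₂ e)) (sym (cong proj₁ e)))

    candidates-parity : parity (place (j , y) b) ≡ not (parity (place (j , y) a))
    candidates-parity = parity-flip _ _ (combine j p) (place-edge j y (φ-edge p))

    evenCarrier : ∀ u w → (∀ t → Carries θ y z t → t ≡ u ⊎ t ≡ w) → Carries θ y z u →
                  Even (proj₁ u) → ¬ Even (proj₁ w) →
                  ExactlyOne (λ t → Even (proj₁ t) × Carries θ y z t)
    evenCarrier u w onlyUW carries-u even-u odd-w = u , (even-u , carries-u) , unique
      where
        unique : ∀ t → Even (proj₁ t) × Carries θ y z t → t ≡ u
        unique t (even-t , carries-t) with onlyUW t carries-t
        ... | inj₁ t≡u = t≡u
        ... | inj₂ refl = contradiction even-t odd-w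

    carriedOnce : ExactlyOne (λ t → Even (proj₁ t) × Carries θ y z t)
    carriedOnce with parity (place (j , y) a) in eq
    ... | false = evenCarrier (candidate a b) (candidate b a) carrier⇒candidate carries-ab
                    eq (λ even → contradiction (trans (sym even) (trans candidates-parity (cong not eq))) λ ())
    ... | true  = evenCarrier (candidate b a) (candidate a b) (λ t → swap⊎ ∘ carrier⇒candidate t) carries-ba
                    (trans candidates-parity (cong not eq)) (λ even → contradiction (trans (sym even) eq) λ ())

  blocks-divide : Divides H N
  blocks-divide = dividesBySelection (λ t → parity (proj₂ t) ≟ᵇ false)
    (cartesianProduct (allFin q) (allVertices N))
    (Unique.cartesianProduct⁺ (Unique.allFin⁺ q) (allVertices-unique N))
    (λ (j , x) → ∈-cartesianProduct⁺ (∈-allFin j) (∈-allVertices x))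
    θ
    (λ y z yz → let i₀ , e = adjacent⇒singleton yz in Carriers.carriedOnce y z i₀ e)

module Walks {n : ℕ} (R : Fin n → Fin n → Set) (R? : ∀ x y → Dec (R x y)) where

  infixr 5 _∷_ _++ʷ_

  data Walk : Fin n → Fin n → Set where
    []  : ∀ {x} → Walk x x
    _∷_ : ∀ {x y z} → R x y → Walk y z → Walk x z

  _++ʷ_ : ∀ {x y z} → Walk x y → Walk y z → Walk x z
  []      ++ʷ w′ = w′
  (r ∷ w) ++ʷ w′ = r ∷ (w ++ʷ w′)

  Fresh : ∀ {m} → Fin n → Vec (Fin n) m → Set
  Fresh x vs = ∀ i → lookup vs i ≢ x

  data Path : Fin n → Fin n → (m : ℕ) → Vec (Fin n) (suc m) → Set where
    stop : ∀ {x} → Path x x 0 (x ∷ [])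
    step : ∀ {x y z m vs} → R x y → Path y z m vs → Fresh x vs → Path x z (suc m) (x ∷ vs)

  SimplePath : Fin n → Fin n → Set
  SimplePath x z = Σ ℕ λ m → Σ (Vec (Fin n) (suc m)) λ vs → Path x z m vs

  path-head : ∀ {x z m vs} → Path x z m vs → lookup vs zero ≡ x
  path-head stop         = refl
  path-head (step _ _ _) = refl

  path-last : ∀ {x z m vs} → Path x z m vs → lookup vs (fromℕ m) ≡ z
  path-last stop         = refl
  path-last (step _ p _) = path-last p

  path-steps : ∀ {x z m vs} → Path x z m vs →
               ∀ (i : Fin m) → R (lookup vs (inject₁ i)) (lookup vs (suc i))
  path-steps (step r p _) zero    = subst (R _) (sym (path-head p)) r
  path-steps (step _ p _) (suc i) = path-steps p i

  path-injective : ∀ {x z m vs} → Path x z m vs → Injective _≡_ _≡_ (lookup vs)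
  path-injective stop           {zero}  {zero}  _  = refl
  path-injective (step _ _ _)   {zero}  {zero}  _  = refl
  path-injective (step _ _ x∉)  {zero}  {suc j} eq = contradiction (sym eq) (x∉ j)
  path-injective (step _ _ x∉)  {suc i} {zero}  eq = contradiction eq (x∉ i)
  path-injective (step _ p _)   {suc i} {suc j} eq = cong suc (path-injective p eq)

  path-length : ∀ {x z m vs} → Path x z m vs → m < n
  path-length p = injective⇒≤ (path-injective p)

  suffix : ∀ {x y z m vs} → Path y z m vs → (i : Fin (suc m)) → lookup vs i ≡ x → SimplePath x z
  suffix p            zero    eq = _ , _ , subst (λ v → Path v _ _ _) (trans (sym (path-head p)) eq) p
  suffix (step _ p _) (suc i) eq = suffix p i eq

  shorten : ∀ {x z} → Walk x z → SimplePath x z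
  shorten []          = 0 , _ , stop
  shorten {x} (r ∷ w) with shorten w
  ... | m , vs , p with any? (λ i → lookup vs i ≟ x)
  ...   | yes (i , eq) = suffix p i eq
  ...   | no x∉       = suc m , x ∷ vs , step r p (λ i eq → x∉ (i , eq))

  Within : ℕ → Fin n → Fin n → Set
  Within zero    x z = x ≡ z
  Within (suc b) x z = x ≡ z ⊎ Σ (Fin n) λ y → R x y × Within b y z

  within? : ∀ b x z → Dec (Within b x z)
  within? zero    x z = x ≟ z
  within? (suc b) x z = (x ≟ z) ⊎-dec any? (λ y → R? x y ×-dec within? b y z)

  within⇒walk : ∀ b {x z} → Within b x z → Walk x z
  within⇒walk zero    refl              = []
  within⇒walk (suc b) (inj₁ refl)       = []
  within⇒walk (suc b) (inj₂ (_ , r , w)) = r ∷ within⇒walk b w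

  path⇒within : ∀ {b x z m vs} → Path x z m vs → m ≤ b → Within b x z
  path⇒within {zero}  stop         _         = refl
  path⇒within {suc b} stop         _         = inj₁ refl
  path⇒within {suc b} (step r p _) (s≤s m≤b) = inj₂ (_ , r , path⇒within p m≤b)

  -- reachability is decidable: a walk exists iff one of at most n steps does
  walk? : ∀ x z → Dec (Walk x z)
  walk? x z = map′ (within⇒walk n) walk⇒within (within? n x z)
    where
      walk⇒within : Walk x z → Within n x z
      walk⇒within w = let _ , _ , p = shorten w in path⇒within p (<⇒≤ (path-length p))

  reverse : (∀ {x y} → R x y → R y x) → ∀ {x z} → Walk x z → Walk z x
  reverse R-sym []      = []
  reverse R-sym (r ∷ w) = reverse R-sym w ++ʷ (R-sym r ∷ [])

-- The
-- coordinate of φ v indexed by the edge a – b records on which side of that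
-- edge v lies, i.e. whether v is joined to b in T minus the edge.  Crossing an
-- edge flips exactly its own coordinate; and distinct vertices are separated
-- by the first edge of the path between them, since the rest of the path
-- avoids that edge.
module TreeLabelling (T : Graph) (tree : IsTree T) where

  Vertex : Set
  Vertex = Fin (V T)

  adj-sym : ∀ {c d} → Adj T c d → Adj T d c
  adj-sym {c} {d} cd = trans (Graph.sym T d c) cd

  Without : Vertex × Vertex → Vertex → Vertex → Set
  Without e c d = Adj T c d × (c , d) ≢ e × (d , c) ≢ e

  without? : ∀ e c d → Dec (Without e c d)
  without? e c d = (adj T c d ≟ᵇ true) ×-dec (¬? ((c , d) ≟₂ e) ×-dec ¬? ((d , c) ≟₂ e))
    where _≟₂_ = ≡-dec _≟_ _≟_

  without-sym : ∀ {e c d} → Without e c d → Without e d c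
  without-sym (cd , ≢₁ , ≢₂) = adj-sym cd , ≢₂ , ≢₁

  module Tw = Walks (Adj T) (λ c d → adj T c d ≟ᵇ true)
  module T∖ (e : Vertex × Vertex) = Walks (Without e) (without? e)

  reach⇒walk : ∀ {c d} → Reach T c d → Tw.Walk c d
  reach⇒walk here        = Tw.[]
  reach⇒walk (step cd r) = cd Tw.∷ reach⇒walk r

  -- a route from a to b avoiding the edge a – b would close a cycle with it
  no-bypass : ∀ {a b} → Adj T a b → ¬ T∖.Walk (a , b) a b
  no-bypass {a} {b} ab w with T∖.shorten (a , b) w
  ... | 0 , _ , T∖.stop = contradiction (trans (sym ab) (irrefl T a)) λ ()
  ... | 1 , _ , T∖.step (_ , ab≢ab , _) T∖.stop _ = ab≢ab refl
  ... | suc (suc m) , vs , path =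
    proj₂ tree m (lookup vs) (T∖.path-injective (a , b) path , steps , closing)
    where
      steps : ∀ i → Adj T (lookup vs (inject₁ i)) (lookup vs (suc i))
      steps i = proj₁ (T∖.path-steps (a , b) path i)
      closing : Adj T (lookup vs (fromℕ (2 + m))) (lookup vs zero)
      closing = subst₂ (Adj T) (sym (T∖.path-last (a , b) path)) (sym (T∖.path-head (a , b) path))
                       (adj-sym ab)

  side : Vertex × Vertex → Vertex → Bool
  side e v = does (T∖.walk? e (proj₂ e) v)

  side-walk : ∀ {e c d} → T∖.Walk e c d → side e c ≡ side e d
  side-walk {e} w = does-⇔ (mk⇔ (_++ʷ w) (_++ʷ reverse without-sym w)) (walk? _ _) (walk? _ _)
    where open T∖ e

  side-across : ∀ {a b} → Adj T a b → side (a , b) a xor side (a , b) b ≡ true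
  side-across {a} {b} ab
    rewrite dec-false (T∖.walk? (a , b) b a) (no-bypass ab ∘ T∖.reverse (a , b) without-sym)
          | dec-true (T∖.walk? (a , b) b b) T∖.[] = refl

  side-along : ∀ {e c d} → Without e c d → side e c xor side e d ≡ false
  side-along {e} {c} {d} cd =
    trans (cong (_xor side e d) (side-walk (cd T∖.∷ T∖.[]))) (xor-same (side e d))

  open EdgeIndexing (edgeIndexing T)

  φ : Vertex → QVertex (edgeCount T)
  φ v = tabulate λ p → side (edge p) v

  lookup-φ⊕φ : ∀ c d p → lookup (φ c ⊕ φ d) p ≡ side (edge p) c xor side (edge p) d
  lookup-φ⊕φ c d p = trans (lookup-zipWith _xor_ p (φ c) (φ d))
                           (cong₂ _xor_ (lookup∘tabulate _ p) (lookup∘tabulate _ p))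

  φ-edge : ∀ p → φ (proj₁ (edge p)) ⊕ φ (proj₂ (edge p)) ≡ ⁅ p ⁆
  φ-edge p = pointwise λ p′ →
    trans (lookup-φ⊕φ a b p′) (trans (coordinate p′) (sym (lookup-⁅⁆ p p′)))
    where
      a = proj₁ (edge p)
      b = proj₂ (edge p)
      coordinate : ∀ p′ → side (edge p′) a xor side (edge p′) b ≡ does (p′ ≟ p)
      coordinate p′ with p′ ≟ p
      ... | yes refl = side-across (edge-adj p)
      ... | no p′≢p  = side-along (edge-adj p , (p′≢p ∘ edge-unique p p′ ∘ inj₁ ∘ sym)
                                              , (p′≢p ∘ edge-unique p p′ ∘ inj₂ ∘ sym))

  labelling : CubeLabelling T (edgeCount T)
  labelling = record { indexing = edgeIndexing T ; φ = φ ; φ-edge = φ-edge }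

  avoid : ∀ {e u} → proj₁ e ≡ u ⊎ proj₂ e ≡ u →
          ∀ {x z m vs} → Tw.Path x z m vs → Tw.Fresh u vs → T∖.Walk e x z
  avoid at-u Tw.stop _ = T∖.[]
  avoid {e} {u} at-u (Tw.step {x = x} {y = y} xy path _) u∉ =
    (xy , notAt-u x≢u y≢u , notAt-u y≢u x≢u) T∖.∷ avoid at-u path (u∉ ∘ suc)
    where
      x≢u : x ≢ u
      x≢u = u∉ zero
      y≢u : y ≢ u
      y≢u y≡u = u∉ (suc zero) (trans (Tw.path-head path) y≡u)
      notAt-u : ∀ {c d} → c ≢ u → d ≢ u → (c , d) ≢ e
      notAt-u c≢u d≢u eq = [ c≢u ∘ trans (cong proj₁ eq) , d≢u ∘ trans (cong proj₂ eq) ] at-u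

  -- distinct u, v are separated by the first edge u – u′ of the path from u to v
  φ-injective : Injective _≡_ _≡_ φ
  φ-injective {u} {v} φu≡φv with Tw.shorten (reach⇒walk (proj₁ tree u v))
  ... | _ , _ , Tw.stop = refl
  ... | _ , _ , Tw.step {y = u′} uu′ path u∉ with CubeLabelling.direction labelling uu′
  ...   | p , orient , φuu′ = contradiction (trans (sym crossing) staying) λ ()
    where
      side-of : ∀ w → lookup (φ w) p ≡ side (edge p) w
      side-of w = lookup∘tabulate _ p
      at-u : proj₁ (edge p) ≡ u ⊎ proj₂ (edge p) ≡ u
      at-u = [ inj₁ ∘ cong proj₁ , inj₂ ∘ cong proj₂ ] orient
      -- u and u′ lie on different sides of the edge p ...
      crossing : side (edge p) u xor side (edge p) u′ ≡ true
      crossing = begin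
        side (edge p) u xor side (edge p) u′  ≡⟨ sym (lookup-φ⊕φ u u′ p) ⟩
        lookup (φ u ⊕ φ u′) p                 ≡⟨ cong (λ w → lookup w p) φuu′ ⟩
        lookup ⁅ p ⁆ p                        ≡⟨ lookup-⁅⁆ p p ⟩
        does (p ≟ p)                          ≡⟨ dec-true (p ≟ p) refl ⟩
        true                                  ∎
      -- ... but u lies on the side of v since φ u ≡ φ v, and so does u′,
      -- being joined to v by the rest of the path, which avoids edge p
      u-with-v : side (edge p) u ≡ side (edge p) v
      u-with-v = trans (sym (side-of u)) (trans (cong (λ w → lookup w p) φu≡φv) (side-of v))
      staying : side (edge p) u xor side (edge p) u′ ≡ false
      staying = begin
        side (edge p) u xor side (edge p) u′  ≡⟨ cong₂ _xor_ u-with-v (side-walk (avoid at-u path u∉)) ⟩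
        side (edge p) v xor side (edge p) v   ≡⟨ xor-same (side (edge p) v) ⟩
        false                                 ∎

tree-divides : (T : Graph) → IsTree T → ∀ q → Divides T (q * edgeCount T)
tree-divides T tree = BlockConstruction.blocks-divide labelling φ-injective
  where open TreeLabelling T tree

corollary4 : (k n : ℕ) → 1 ≤ k → 1 ≤ n → k ∣ n →
    (T : Graph) → IsTree T → edgeCount T ≡ k → Divides T n
corollary4 k n _ _ (divides q n≡q*k) T tree edges≡k =
  subst (Divides T) (sym n≡q*k) (subst (λ K → Divides T (q * K)) edges≡k (tree-divides T tree q))
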